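{- Let $\mathcal{C}$ be a category and $\mathcal{D}$ a symmetric monoidal category. Then the functor category $[\mathcal{C},\mathcal{D}]$ is symmetric monoidal under pointwise tensor products, and, regarding $\mathrm{ZI}(\mathcal{D})$ as a full subcategory of the slice category $\mathcal{D}/I$, there is an isomorphism of categories $\mathrm{ZI}([\mathcal{C},\mathcal{D}])\simeq[\mathcal{C},\mathrm{ZI}(\mathcal{D})]$.
   Context: In a symmetric monoidal category with unit $I$ and unitors $\lambda,\rho$, a central idempotent is a morphism $u\colon U\to I$ such that $\rho_U\circ(U\otimes u)=\lambda_U\circ(u\otimes U)\colon U\otimes U\to U$ and this morphism is invertible; two central idempotents $u,v$ are identified when $u=v\circ m$ for an isomorphism $m$. $\mathrm{ZI}$ of a symmetric monoidal category denotes its collection of central idempotents, ordered by $u\leq v$ iff $u=v\circ m$ for some morphism $m$ (equivalently, viewed inside the slice over $I$). In $[\mathcal{C},\mathcal{D}]$ the tensor unit is the constant functor at $I$. -}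

module Defs where

open import Level using (Level; _⊔_) renaming (suc to lsuc)
open import Relation.Binary using (Setoid; IsEquivalence)
import Relation.Binary.Reasoning.Setoid as SetoidR

record Category (o ℓ e : Level) : Set (lsuc (o ⊔ ℓ ⊔ e)) where
  infix  4 _≈_
  infixr 9 _∘_
  field
    Obj : Set o
    _⇒_ : Obj → Obj → Set ℓ
    _≈_ : ∀ {A B} → (A ⇒ B) → (A ⇒ B) → Set e
    id  : ∀ {A} → A ⇒ A
    _∘_ : ∀ {A B C} → B ⇒ C → A ⇒ B → A ⇒ C
    equiv     : ∀ {A B} → IsEquivalence (_≈_ {A} {B})
    assoc     : ∀ {A B C D} {f : A ⇒ B} {g : B ⇒ C} {h : C ⇒ D} →
                (h ∘ g) ∘ f ≈ h ∘ (g ∘ f)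
    identityˡ : ∀ {A B} {f : A ⇒ B} → id ∘ f ≈ f
    identityʳ : ∀ {A B} {f : A ⇒ B} → f ∘ id ≈ f
    ∘-resp-≈  : ∀ {A B C} {f h : B ⇒ C} {g i : A ⇒ B} →
                f ≈ h → g ≈ i → f ∘ g ≈ h ∘ i

  hom-setoid : Obj → Obj → Setoid ℓ e
  hom-setoid A B = record { Carrier = A ⇒ B ; _≈_ = _≈_ ; isEquivalence = equiv }

  module Equiv {A B : Obj} = IsEquivalence (equiv {A} {B})

  record IsIso {A B : Obj} (f : A ⇒ B) : Set (ℓ ⊔ e) where
    field
      inv  : B ⇒ A
      isoˡ : inv ∘ f ≈ id
      isoʳ : f ∘ inv ≈ id


record Functor {o ℓ e o′ ℓ′ e′} (C : Category o ℓ e) (D : Category o′ ℓ′ e′)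
       : Set (o ⊔ ℓ ⊔ e ⊔ o′ ⊔ ℓ′ ⊔ e′) where
  field
    F₀ : Category.Obj C → Category.Obj D
    F₁ : ∀ {A B} → Category._⇒_ C A B → Category._⇒_ D (F₀ A) (F₀ B)
    identity     : ∀ {A} → Category._≈_ D (F₁ (Category.id C {A})) (Category.id D)
    homomorphism : ∀ {X Y Z} {f : Category._⇒_ C X Y} {g : Category._⇒_ C Y Z} →
                   Category._≈_ D (F₁ (Category._∘_ C g f)) (Category._∘_ D (F₁ g) (F₁ f))
    F-resp-≈     : ∀ {A B} {f g : Category._⇒_ C A B} → Category._≈_ C f g → Category._≈_ D (F₁ f) (F₁ g)

open Functor

record NatTrans {o ℓ e o′ ℓ′ e′} {C : Category o ℓ e} {D : Category o′ ℓ′ e′}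
       (F G : Functor C D) : Set (o ⊔ ℓ ⊔ ℓ′ ⊔ e′) where
  field
    η       : ∀ X → Category._⇒_ D (F₀ F X) (F₀ G X)
    commute : ∀ {X Y} (f : Category._⇒_ C X Y) →
              Category._≈_ D (Category._∘_ D (η Y) (F₁ F f)) (Category._∘_ D (F₁ G f) (η X))

open NatTrans

module _ {o ℓ e o′ ℓ′ e′} (C : Category o ℓ e) (D : Category o′ ℓ′ e′) where
  private
    module D = Category D

  idNT : ∀ {F : Functor C D} → NatTrans F F
  idNT {F} = record
    { η = λ X → D.id
    ; commute = λ f → D.Equiv.trans D.identityˡ (D.Equiv.sym D.identityʳ) }

  _∘NT_ : ∀ {F G H : Functor C D} → NatTrans G H → NatTrans F G → NatTrans F H
  _∘NT_ {F} {G} {H} β α = record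
    { η = λ X → η β X D.∘ η α X
    ; commute = λ {X} {Y} f → let open SetoidR (D.hom-setoid (F₀ F X) (F₀ H Y)) in begin
        (η β Y D.∘ η α Y) D.∘ F₁ F f   ≈⟨ D.assoc ⟩
        η β Y D.∘ (η α Y D.∘ F₁ F f)   ≈⟨ D.∘-resp-≈ D.Equiv.refl (commute α f) ⟩
        η β Y D.∘ (F₁ G f D.∘ η α X)   ≈⟨ D.Equiv.sym D.assoc ⟩
        (η β Y D.∘ F₁ G f) D.∘ η α X   ≈⟨ D.∘-resp-≈ (commute β f) D.Equiv.refl ⟩
        (F₁ H f D.∘ η β X) D.∘ η α X   ≈⟨ D.assoc ⟩
        F₁ H f D.∘ (η β X D.∘ η α X)   ∎ }

  Functors : Category (o ⊔ ℓ ⊔ e ⊔ o′ ⊔ ℓ′ ⊔ e′) (o ⊔ ℓ ⊔ ℓ′ ⊔ e′) (o ⊔ e′)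
  Functors = record
    { Obj = Functor C D
    ; _⇒_ = NatTrans
    ; _≈_ = λ α β → ∀ X → η α X D.≈ η β X
    ; id = idNT
    ; _∘_ = _∘NT_
    ; equiv = record
      { refl = λ X → D.Equiv.refl
      ; sym = λ p X → D.Equiv.sym (p X)
      ; trans = λ p q X → D.Equiv.trans (p X) (q X) }
    ; assoc = λ X → D.assoc
    ; identityˡ = λ X → D.identityˡ
    ; identityʳ = λ X → D.identityʳ
    ; ∘-resp-≈ = λ p q X → D.∘-resp-≈ (p X) (q X)
    }

idF : ∀ {o ℓ e} {C : Category o ℓ e} → Functor C C
idF {C = C} = record
  { F₀ = λ X → X ; F₁ = λ f → f
  ; identity = Category.Equiv.refl C ; homomorphism = Category.Equiv.refl C ; F-resp-≈ = λ p → p }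

_∘F_ : ∀ {o ℓ e o′ ℓ′ e′ o″ ℓ″ e″}
         {A : Category o ℓ e} {B : Category o′ ℓ′ e′} {C : Category o″ ℓ″ e″} →
       Functor B C → Functor A B → Functor A C
_∘F_ {C = C} G F = record
  { F₀ = λ X → F₀ G (F₀ F X)
  ; F₁ = λ f → F₁ G (F₁ F f)
  ; identity = Category.Equiv.trans C (F-resp-≈ G (identity F)) (identity G)
  ; homomorphism = Category.Equiv.trans C (F-resp-≈ G (homomorphism F)) (homomorphism G)
  ; F-resp-≈ = λ p → F-resp-≈ G (F-resp-≈ F p) }

record NatIso {o ℓ e o′ ℓ′ e′} {C : Category o ℓ e} {D : Category o′ ℓ′ e′}
       (F G : Functor C D) : Set (o ⊔ ℓ ⊔ ℓ′ ⊔ e′) where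
  field
    F⇒G  : NatTrans F G
    F⇐G  : NatTrans G F
    isoˡ : ∀ X → Category._≈_ D (Category._∘_ D (η F⇐G X) (η F⇒G X)) (Category.id D)
    isoʳ : ∀ X → Category._≈_ D (Category._∘_ D (η F⇒G X) (η F⇐G X)) (Category.id D)

-- Isomorphism of categories whose objects are taken up to isomorphism
-- (as for ZI, whose elements are identified along isomorphisms):
-- functors both ways whose composites are isomorphic to the identities.
record CatIso {o ℓ e o′ ℓ′ e′} (A : Category o ℓ e) (B : Category o′ ℓ′ e′)
       : Set (o ⊔ ℓ ⊔ e ⊔ o′ ⊔ ℓ′ ⊔ e′) where
  field
    to      : Functor A B
    from    : Functor B A
    from∘to : NatIso (from ∘F to) idF
    to∘from : NatIso (to ∘F from) idF

record MonoidalData {o ℓ e} (C : Category o ℓ e) : Set (o ⊔ ℓ ⊔ e) where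
  open Category C
  infixr 10 _⊗₀_ _⊗₁_
  field
    _⊗₀_ : Obj → Obj → Obj
    _⊗₁_ : ∀ {A B X Y} → A ⇒ B → X ⇒ Y → (A ⊗₀ X) ⇒ (B ⊗₀ Y)
    ⊗-identity     : ∀ {A X} → (id {A} ⊗₁ id {X}) ≈ id
    ⊗-homomorphism : ∀ {A B C X Y Z} {f : A ⇒ B} {g : B ⇒ C} {h : X ⇒ Y} {k : Y ⇒ Z} →
                     ((g ∘ f) ⊗₁ (k ∘ h)) ≈ ((g ⊗₁ k) ∘ (f ⊗₁ h))
    ⊗-resp-≈       : ∀ {A B X Y} {f f′ : A ⇒ B} {g g′ : X ⇒ Y} →
                     f ≈ f′ → g ≈ g′ → (f ⊗₁ g) ≈ (f′ ⊗₁ g′)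
    unit : Obj
    unitorˡ : ∀ {X} → (unit ⊗₀ X) ⇒ X
    unitorʳ : ∀ {X} → (X ⊗₀ unit) ⇒ X
    associator : ∀ {X Y Z} → ((X ⊗₀ Y) ⊗₀ Z) ⇒ (X ⊗₀ (Y ⊗₀ Z))
    unitorˡ⁻¹ : ∀ {X} → X ⇒ (unit ⊗₀ X)
    unitorʳ⁻¹ : ∀ {X} → X ⇒ (X ⊗₀ unit)
    associator⁻¹ : ∀ {X Y Z} → (X ⊗₀ (Y ⊗₀ Z)) ⇒ ((X ⊗₀ Y) ⊗₀ Z)

record IsMonoidal {o ℓ e} {C : Category o ℓ e} (M : MonoidalData C) : Set (o ⊔ ℓ ⊔ e) where
  open Category C
  open MonoidalData M
  field
    unitorˡ-isoˡ : ∀ {X} → (unitorˡ⁻¹ ∘ unitorˡ {X}) ≈ id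
    unitorˡ-isoʳ : ∀ {X} → (unitorˡ {X} ∘ unitorˡ⁻¹) ≈ id
    unitorʳ-isoˡ : ∀ {X} → (unitorʳ⁻¹ ∘ unitorʳ {X}) ≈ id
    unitorʳ-isoʳ : ∀ {X} → (unitorʳ {X} ∘ unitorʳ⁻¹) ≈ id
    associator-isoˡ : ∀ {X Y Z} → (associator⁻¹ ∘ associator {X} {Y} {Z}) ≈ id
    associator-isoʳ : ∀ {X Y Z} → (associator {X} {Y} {Z} ∘ associator⁻¹) ≈ id
    unitorˡ-natural : ∀ {X Y} {f : X ⇒ Y} → (unitorˡ ∘ (id ⊗₁ f)) ≈ (f ∘ unitorˡ)
    unitorʳ-natural : ∀ {X Y} {f : X ⇒ Y} → (unitorʳ ∘ (f ⊗₁ id)) ≈ (f ∘ unitorʳ)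
    associator-natural : ∀ {X X′ Y Y′ Z Z′} {f : X ⇒ X′} {g : Y ⇒ Y′} {h : Z ⇒ Z′} →
                         (associator ∘ ((f ⊗₁ g) ⊗₁ h)) ≈ ((f ⊗₁ (g ⊗₁ h)) ∘ associator)
    triangle : ∀ {X Y} → ((id {X} ⊗₁ unitorˡ {Y}) ∘ associator) ≈ (unitorʳ ⊗₁ id)
    pentagon : ∀ {W X Y Z} →
               ((id {W} ⊗₁ associator {X} {Y} {Z}) ∘ (associator ∘ (associator ⊗₁ id)))
                 ≈ (associator ∘ associator)

record SymmetricData {o ℓ e} {C : Category o ℓ e} (M : MonoidalData C) : Set (o ⊔ ℓ) where
  open Category C
  open MonoidalData M
  field
    braiding : ∀ {X Y} → (X ⊗₀ Y) ⇒ (Y ⊗₀ X)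

record IsSymmetric {o ℓ e} {C : Category o ℓ e} {M : MonoidalData C}
       (S : SymmetricData M) : Set (o ⊔ ℓ ⊔ e) where
  open Category C
  open MonoidalData M
  open SymmetricData S
  field
    braiding-natural : ∀ {X X′ Y Y′} {f : X ⇒ X′} {g : Y ⇒ Y′} →
                       (braiding ∘ (f ⊗₁ g)) ≈ ((g ⊗₁ f) ∘ braiding)
    commutative : ∀ {X Y} → (braiding {Y} {X} ∘ braiding {X} {Y}) ≈ id
    hexagon : ∀ {X Y Z} →
              (associator {Y} {Z} {X} ∘ (braiding {X} {Y ⊗₀ Z} ∘ associator))
                ≈ ((id ⊗₁ braiding {X} {Z}) ∘ (associator ∘ (braiding {X} {Y} ⊗₁ id)))

-- In any category: the pointwise inverse of a natural family is natural.
inverse-square : ∀ {o ℓ e} (D : Category o ℓ e) {A A′ B B′ : Category.Obj D}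
  {a : Category._⇒_ D A A′} {b : Category._⇒_ D B B′} {cA : Category._⇒_ D A B} {dA : Category._⇒_ D B A}
  {cA′ : Category._⇒_ D A′ B′} {dA′ : Category._⇒_ D B′ A′} →
  Category._≈_ D (Category._∘_ D cA′ a) (Category._∘_ D b cA) →
  Category._≈_ D (Category._∘_ D cA dA) (Category.id D) → Category._≈_ D (Category._∘_ D dA′ cA′) (Category.id D) →
  Category._≈_ D (Category._∘_ D dA′ b) (Category._∘_ D a dA)
inverse-square D {a = a} {b} {cA} {dA} {cA′} {dA′} sqr isoA isoA′ = begin
    dA′ ∘ b                         ≈⟨ sym identityʳ ⟩
    (dA′ ∘ b) ∘ id                  ≈⟨ ∘-resp-≈ refl (sym isoA) ⟩
    (dA′ ∘ b) ∘ (cA ∘ dA)           ≈⟨ sym assoc ⟩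
    ((dA′ ∘ b) ∘ cA) ∘ dA           ≈⟨ ∘-resp-≈ assoc refl ⟩
    (dA′ ∘ (b ∘ cA)) ∘ dA           ≈⟨ ∘-resp-≈ (∘-resp-≈ refl (sym sqr)) refl ⟩
    (dA′ ∘ (cA′ ∘ a)) ∘ dA          ≈⟨ ∘-resp-≈ (sym assoc) refl ⟩
    ((dA′ ∘ cA′) ∘ a) ∘ dA          ≈⟨ ∘-resp-≈ (∘-resp-≈ isoA′ refl) refl ⟩
    (id ∘ a) ∘ dA                   ≈⟨ ∘-resp-≈ identityˡ refl ⟩
    a ∘ dA                          ∎
  where open Category D renaming (module Equiv to E)
        open E
        open SetoidR (Category.hom-setoid D _ _)

module Pointwise {o ℓ e o′ ℓ′ e′} (C : Category o ℓ e) (D : Category o′ ℓ′ e′)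
                 (M : MonoidalData D) (isM : IsMonoidal M) where
  private
    module D = Category D
  open MonoidalData M
  open IsMonoidal isM

  _⊛_ : Functor C D → Functor C D → Functor C D
  F ⊛ G = record
    { F₀ = λ X → F₀ F X ⊗₀ F₀ G X
    ; F₁ = λ f → F₁ F f ⊗₁ F₁ G f
    ; identity = D.Equiv.trans (⊗-resp-≈ (identity F) (identity G)) ⊗-identity
    ; homomorphism = D.Equiv.trans (⊗-resp-≈ (homomorphism F) (homomorphism G)) ⊗-homomorphism
    ; F-resp-≈ = λ p → ⊗-resp-≈ (F-resp-≈ F p) (F-resp-≈ G p) }

  ConstI : Functor C D
  ConstI = record
    { F₀ = λ _ → unit ; F₁ = λ _ → D.id
    ; identity = D.Equiv.refl ; homomorphism = D.Equiv.sym D.identityˡ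
    ; F-resp-≈ = λ _ → D.Equiv.refl }

  _⊛₁_ : ∀ {F F′ G G′} → NatTrans F F′ → NatTrans G G′ → NatTrans (F ⊛ G) (F′ ⊛ G′)
  _⊛₁_ {F} {F′} {G} {G′} α β = record
    { η = λ X → η α X ⊗₁ η β X
    ; commute = λ f → D.Equiv.trans (D.Equiv.sym ⊗-homomorphism)
                 (D.Equiv.trans (⊗-resp-≈ (commute α f) (commute β f)) ⊗-homomorphism) }

  private
    sq : ∀ {F G : Functor C D} (c : ∀ X → D._⇒_ (F₀ F X) (F₀ G X)) →
         (∀ {X Y} (f : Category._⇒_ C X Y) → (c Y D.∘ F₁ F f) D.≈ (F₁ G f D.∘ c X)) → NatTrans F G
    sq c p = record { η = c ; commute = p }

  λP : ∀ {F} → NatTrans (ConstI ⊛ F) F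
  λP {F} = sq (λ X → unitorˡ) (λ f → unitorˡ-natural)

  λP⁻¹ : ∀ {F} → NatTrans F (ConstI ⊛ F)
  λP⁻¹ {F} = sq (λ X → unitorˡ⁻¹)
    (λ f → inverse-square D (unitorˡ-natural {f = F₁ F f}) unitorˡ-isoʳ unitorˡ-isoˡ)

  ρP : ∀ {F} → NatTrans (F ⊛ ConstI) F
  ρP {F} = sq (λ X → unitorʳ) (λ f → unitorʳ-natural)

  ρP⁻¹ : ∀ {F} → NatTrans F (F ⊛ ConstI)
  ρP⁻¹ {F} = sq (λ X → unitorʳ⁻¹)
    (λ f → inverse-square D (unitorʳ-natural {f = F₁ F f}) unitorʳ-isoʳ unitorʳ-isoˡ)

  αP : ∀ {F G H} → NatTrans ((F ⊛ G) ⊛ H) (F ⊛ (G ⊛ H))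
  αP = sq (λ X → associator) (λ f → associator-natural)

  αP⁻¹ : ∀ {F G H} → NatTrans (F ⊛ (G ⊛ H)) ((F ⊛ G) ⊛ H)
  αP⁻¹ = sq (λ X → associator⁻¹)
    (λ f → inverse-square D associator-natural associator-isoʳ associator-isoˡ)

  pointwise : MonoidalData (Functors C D)
  pointwise = record
    { _⊗₀_ = _⊛_
    ; _⊗₁_ = _⊛₁_
    ; ⊗-identity = λ X → ⊗-identity
    ; ⊗-homomorphism = λ X → ⊗-homomorphism
    ; ⊗-resp-≈ = λ p q X → ⊗-resp-≈ (p X) (q X)
    ; unit = ConstI
    ; unitorˡ = λP
    ; unitorʳ = ρP
    ; associator = αP
    ; unitorˡ⁻¹ = λP⁻¹
    ; unitorʳ⁻¹ = ρP⁻¹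
    ; associator⁻¹ = αP⁻¹ }

  pointwiseSym : (S : SymmetricData M) → IsSymmetric S → SymmetricData pointwise
  pointwiseSym S isS = record
    { braiding = sq (λ X → SymmetricData.braiding S) (λ f → IsSymmetric.braiding-natural isS) }

module _ {o ℓ e} (C : Category o ℓ e) (M : MonoidalData C) where
  open Category C
  open MonoidalData M

  record IsCentralIdempotent {U : Obj} (u : U ⇒ unit) : Set (ℓ ⊔ e) where
    field
      central    : (unitorʳ {U} ∘ (id {U} ⊗₁ u)) ≈ (unitorˡ {U} ∘ (u ⊗₁ id {U}))
      invertible : IsIso (unitorʳ {U} ∘ (id {U} ⊗₁ u))

  record CentralIdempotent : Set (o ⊔ ℓ ⊔ e) where
    field
      U   : Obj
      u   : U ⇒ unit
      isCI : IsCentralIdempotent u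

  open CentralIdempotent

  record ZIHom (x y : CentralIdempotent) : Set (ℓ ⊔ e) where
    field
      m       : U x ⇒ U y
      over    : (u y ∘ m) ≈ u x

  open ZIHom

  ZI : Category (o ⊔ ℓ ⊔ e) (ℓ ⊔ e) e
  ZI = record
    { Obj = CentralIdempotent
    ; _⇒_ = ZIHom
    ; _≈_ = λ f g → m f ≈ m g
    ; id = record { m = id ; over = identityʳ }
    ; _∘_ = λ g f → record
      { m = m g ∘ m f
      ; over = Equiv.trans (Equiv.sym assoc)
                 (Equiv.trans (∘-resp-≈ (over g) Equiv.refl) (over f)) }
    ; equiv = record { refl = Equiv.refl ; sym = Equiv.sym ; trans = Equiv.trans }
    ; assoc = assoc
    ; identityˡ = identityˡ
    ; identityʳ = identityʳ
    ; ∘-resp-≈ = ∘-resp-≈ }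

{-# OPTIONS --safe #-}
module Submission where

-- Everything in [C,D] is computed componentwise: the monoidal laws hold because they
-- hold at each object, and a natural transformation is invertible exactly when all its
-- components are (the componentwise inverses are automatically natural). Hence u : U ⇒ I
-- is a central idempotent in [C,D] iff every u_X is one in D, and a morphism over I in
-- [C,D] is a natural family of morphisms over I in D. Both composites of the resulting
-- functors are the identity on underlying data, so their comparison maps are identities.

open import Defs
open import Data.Product using (_×_; _,_)

open Functor
open NatTrans

id-comm : ∀ {o ℓ e} (D : Category o ℓ e) {A B} {f : Category._⇒_ D A B} →
          Category._≈_ D (Category._∘_ D (Category.id D) f) (Category._∘_ D f (Category.id D))
id-comm D = trans identityˡ (sym identityʳ)
  where open Category D
        open Equiv

module _ {o ℓ e o′ ℓ′ e′} {C : Category o ℓ e} {D : Category o′ ℓ′ e′}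
         {F G : Functor C D} {α : NatTrans F G} where
  private
    module D = Category D

  isIso-components : Category.IsIso (Functors C D) α → ∀ X → D.IsIso (η α X)
  isIso-components iso X = record
    { inv = η inv X ; isoˡ = isoˡ X ; isoʳ = isoʳ X }
    where open Category.IsIso iso

  isIso-fromComponents : (∀ X → D.IsIso (η α X)) → Category.IsIso (Functors C D) α
  isIso-fromComponents iso = record
    { inv = record
      { η = λ X → D.IsIso.inv (iso X)
      ; commute = λ {X} {Y} f →
          inverse-square D (commute α f) (D.IsIso.isoʳ (iso X)) (D.IsIso.isoˡ (iso Y)) }
    ; isoˡ = λ X → D.IsIso.isoˡ (iso X)
    ; isoʳ = λ X → D.IsIso.isoʳ (iso X) }

module PointwiseMonoidal {o ℓ e o′ ℓ′ e′} (C : Category o ℓ e) (D : Category o′ ℓ′ e′)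
                         (M : MonoidalData D) (isM : IsMonoidal M) where
  open IsMonoidal isM
  open Pointwise C D M isM

  pointwise-isMonoidal : IsMonoidal pointwise
  pointwise-isMonoidal = record
    { unitorˡ-isoˡ = λ _ → unitorˡ-isoˡ
    ; unitorˡ-isoʳ = λ _ → unitorˡ-isoʳ
    ; unitorʳ-isoˡ = λ _ → unitorʳ-isoˡ
    ; unitorʳ-isoʳ = λ _ → unitorʳ-isoʳ
    ; associator-isoˡ = λ _ → associator-isoˡ
    ; associator-isoʳ = λ _ → associator-isoʳ
    ; unitorˡ-natural = λ _ → unitorˡ-natural
    ; unitorʳ-natural = λ _ → unitorʳ-natural
    ; associator-natural = λ _ → associator-natural
    ; triangle = λ _ → triangle
    ; pentagon = λ _ → pentagon }

  pointwise-isSymmetric : (S : SymmetricData M) (isS : IsSymmetric S) →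
                          IsSymmetric (pointwiseSym S isS)
  pointwise-isSymmetric S isS = record
    { braiding-natural = λ _ → braiding-natural
    ; commutative = λ _ → commutative
    ; hexagon = λ _ → hexagon }
    where open IsSymmetric isS

module CentralIdempotentsOfFunctors {o ℓ e o′ ℓ′ e′}
         (C : Category o ℓ e) (D : Category o′ ℓ′ e′)
         (M : MonoidalData D) (isM : IsMonoidal M) where
  private
    module D = Category D
    [C,D] = Functors C D
    ZD = ZI D M
    Z[C,D] = ZI [C,D] (Pointwise.pointwise C D M isM)
  open D.Equiv
  open Pointwise C D M isM
  open CentralIdempotent
  open IsCentralIdempotent
  open ZIHom

  isCentralIdempotent-components : ∀ {U} {u : NatTrans U ConstI} →
    IsCentralIdempotent [C,D] pointwise u → ∀ X → IsCentralIdempotent D M (η u X)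
  isCentralIdempotent-components ci X = record
    { central = central ci X
    ; invertible = isIso-components (invertible ci) X }

  isCentralIdempotent-fromComponents : ∀ {U} {u : NatTrans U ConstI} →
    (∀ X → IsCentralIdempotent D M (η u X)) → IsCentralIdempotent [C,D] pointwise u
  isCentralIdempotent-fromComponents ci = record
    { central = λ X → central (ci X)
    ; invertible = isIso-fromComponents (λ X → invertible (ci X)) }

  toObj : CentralIdempotent [C,D] pointwise → Functor C ZD
  toObj x = record
    { F₀ = λ X → record
      { U = F₀ (U x) X ; u = η (u x) X
      ; isCI = isCentralIdempotent-components (isCI x) X }
    ; F₁ = λ f → record { m = F₁ (U x) f ; over = trans (commute (u x) f) D.identityˡ }
    ; identity = identity (U x)
    ; homomorphism = homomorphism (U x)
    ; F-resp-≈ = F-resp-≈ (U x) }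

  fromObj : Functor C ZD → CentralIdempotent [C,D] pointwise
  fromObj G = record
    { U = record
      { F₀ = λ X → U (F₀ G X) ; F₁ = λ f → m (F₁ G f)
      ; identity = identity G ; homomorphism = homomorphism G
      ; F-resp-≈ = F-resp-≈ G }
    ; u = record
      { η = λ X → u (F₀ G X)
      ; commute = λ f → trans (over (F₁ G f)) (sym D.identityˡ) }
    ; isCI = isCentralIdempotent-fromComponents (λ X → isCI (F₀ G X)) }

  to : Functor Z[C,D] (Functors C ZD)
  to = record
    { F₀ = toObj
    ; F₁ = λ α → record
      { η = λ X → record { m = η (m α) X ; over = over α X }
      ; commute = commute (m α) }
    ; identity = λ _ → refl ; homomorphism = λ _ → refl ; F-resp-≈ = λ p → p }

  from : Functor (Functors C ZD) Z[C,D]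
  from = record
    { F₀ = fromObj
    ; F₁ = λ α → record
      { m = record { η = λ X → m (η α X) ; commute = commute α }
      ; over = λ X → over (η α X) }
    ; identity = λ _ → refl ; homomorphism = λ _ → refl ; F-resp-≈ = λ p → p }

  -- The composites fix the underlying data only up to the proofs in the `over` fields,
  -- so the identity comparison maps must be rebuilt rather than taken from Category.id.
  from∘to≅id : NatIso (from ∘F to) idF
  from∘to≅id = record
    { F⇒G = record
      { η = λ _ → record { m = idNT C D ; over = λ _ → D.identityʳ }
      ; commute = λ _ _ → id-comm D }
    ; F⇐G = record
      { η = λ _ → record { m = idNT C D ; over = λ _ → D.identityʳ }
      ; commute = λ _ _ → id-comm D }
    ; isoˡ = λ _ _ → D.identityˡ
    ; isoʳ = λ _ _ → D.identityˡ }

  to∘from≅id : NatIso (to ∘F from) idF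
  to∘from≅id = record
    { F⇒G = record
      { η = λ _ → record
        { η = λ _ → record { m = D.id ; over = D.identityʳ }
        ; commute = λ _ → id-comm D }
      ; commute = λ _ _ → id-comm D }
    ; F⇐G = record
      { η = λ _ → record
        { η = λ _ → record { m = D.id ; over = D.identityʳ }
        ; commute = λ _ → id-comm D }
      ; commute = λ _ _ → id-comm D }
    ; isoˡ = λ _ _ → D.identityˡ
    ; isoʳ = λ _ _ → D.identityˡ }

  ZI-Functors≅Functors-ZI : CatIso Z[C,D] (Functors C ZD)
  ZI-Functors≅Functors-ZI = record
    { to = to ; from = from ; from∘to = from∘to≅id ; to∘from = to∘from≅id }

lemma5p1 : ∀ {o ℓ e o′ ℓ′ e′} (C : Category o ℓ e) (D : Category o′ ℓ′ e′)
           (M : MonoidalData D) (isM : IsMonoidal M)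
           (S : SymmetricData M) (isS : IsSymmetric S) →
           IsMonoidal (Pointwise.pointwise C D M isM)
           × IsSymmetric (Pointwise.pointwiseSym C D M isM S isS)
           × CatIso (ZI (Functors C D) (Pointwise.pointwise C D M isM)) (Functors C (ZI D M))
lemma5p1 C D M isM S isS =
  pointwise-isMonoidal , pointwise-isSymmetric S isS , ZI-Functors≅Functors-ZI
  where
    open PointwiseMonoidal C D M isM
    open CentralIdempotentsOfFunctors C D M isM
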